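{- The class $\mathsf{SPARSE}$ is $\mathsf{P}$-loc-meager.
   Context: $\mathsf{SPARSE}$ is the class of languages $L$ for which there is a polynomial $p$ with $|L\cap\{0,1\}^n|\le p(n)$ for all $n\ge1$. Strings are enumerated $s_0=\lambda,s_1,\dots$ by length then lexicographically; a language $L$ is identified with its characteristic sequence $\chi_L$. A strategy is $h:\{0,1\}^*\to\{0,1\}^*$ with $\tau\sqsubseteq h(\tau)$; $h$ avoids $A$ if $h(\tau)\not\sqsubseteq\chi_A$ for all $\tau$. An indexed strategy $h$ has each $h_i$ a strategy; if $h_i(\tau)=\tau w$, $\mathrm{ext}(h_i(\tau),k)=w[k]$ for $1\le k\le|w|$ and $\perp$ otherwise. $h$ is $\mathsf{P}$-loc-computable if a random-access Turing machine $M$ (querying bits of $\tau$ as an oracle, also given $s_{|\tau|}$) computes $M^\tau(s_{|\tau|},i,k)=\mathrm{ext}(h_i(\tau),k)$ in time $t(\log|\tau|+|i|+|k|)$ for some polynomial $t$, with a query set $G$, $G(n,i,k)$ printable in time $t(n+|i|+|k|)$, such that for all $i'\le i$, $k'\le k$ and $\sigma$ with $\log|\sigma|\le n$, $M^\sigma(s_{|\sigma|},i',k')$ only queries bits of $\sigma$ in $G(n,i,k)$. A class $X$ is $\mathsf{P}$-loc-meager if some $\mathsf{P}$-loc-computable indexed strategy $h$ has, for every $L\in X$, an $i$ with $h_i$ avoiding $L$. -}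

module Defs where

open import Data.Nat using (ℕ; zero; suc; _+_; _*_; _^_; _≤_; _≡ᵇ_)
open import Data.Nat.DivMod using (_/_; _%_)
open import Data.Nat.Logarithm using (⌈log₂_⌉)
open import Data.Bool using (Bool; true; false; if_then_else_)
open import Data.List using (List; []; _∷_; _++_; length; reverse; map; drop; replicate; foldr)
open import Data.Nat.ListAction using (sum)
open import Data.List.Membership.Propositional using (_∈_)
open import Data.Maybe using (Maybe; just; nothing)
open import Data.Fin using (Fin; zero; suc)
open import Data.Product using (Σ; _×_; _,_; ∃)
open import Data.Unit using (⊤)
open import Data.Empty using (⊥)
open import Relation.Nullary using (¬_)
open import Relation.Binary.PropositionalEquality using (_≡_)

-- least-significant-first bits of n (fuel-driven; fuel n suffices)
bitsRev : ℕ → ℕ → List Bool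
bitsRev zero    n       = []
bitsRev (suc f) zero    = []
bitsRev (suc f) (suc n) = ((suc n % 2) ≡ᵇ 1) ∷ bitsRev f (suc n / 2)

-- standard binary representation of n (most significant bit first, no
-- leading zeros; bin 0 = empty)
bin : ℕ → List Bool
bin n = reverse (bitsRev n n)

‖_‖ : ℕ → ℕ
‖ n ‖ = length (bin n)

-- s_n : the n-th string in length-lexicographic order
-- (binary representation of n+1 with its leading 1 removed)
strAt : ℕ → List Bool
strAt n = drop 1 (bin (suc n))

Language : Set
Language = List Bool → Bool

χ : Language → ℕ → Bool
χ L n = L (strAt n)

allStrings : ℕ → List (List Bool)
allStrings zero    = [] ∷ []
allStrings (suc n) = map (false ∷_) (allStrings n) ++ map (true ∷_) (allStrings n)

census : Language → ℕ → ℕ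
census L n = sum (map (λ w → if L w then 1 else 0) (allStrings n))

-- the polynomial-shaped bound c·x^d + c (every polynomial is bounded by one)
poly : ℕ → ℕ → ℕ → ℕ
poly c d x = c * x ^ d + c

SPARSE : Language → Set
SPARSE L = Σ ℕ λ c → Σ ℕ λ d → ∀ n → 1 ≤ n → census L n ≤ poly c d n

prefixFrom : ℕ → List Bool → (ℕ → Bool) → Set
prefixFrom off []      f = ⊤
prefixFrom off (b ∷ u) f = (b ≡ f off) × prefixFrom (suc off) u f

_⊑χ_ : List Bool → (ℕ → Bool) → Set
u ⊑χ f = prefixFrom 0 u f

IsStrategy : (List Bool → List Bool) → Set
IsStrategy h = ∀ τ → ∃ λ w → h τ ≡ τ ++ w

Avoids : (List Bool → List Bool) → Language → Set
Avoids h A = ∀ τ → ¬ (h τ ⊑χ χ A)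

lookupMaybe : List Bool → ℕ → Maybe Bool
lookupMaybe []      _       = nothing
lookupMaybe (b ∷ u) zero    = just b
lookupMaybe (b ∷ u) (suc k) = lookupMaybe u k

-- ext(h_i(τ), k) where u = h_i(τ) = τ w : w[k] (1-based), ⊥ = nothing
ext : List Bool → List Bool → ℕ → Maybe Bool
ext τ u zero    = nothing
ext τ u (suc k) = lookupMaybe (drop (length τ) u) k

-- Two one-way-infinite tapes: a work tape (holding the input initially and
-- the output of printers) and a query tape.  Tape alphabet Fin (4 + e):
--   0 = blank, 1 = bit 0, 2 = bit 1, 3 = separator #, others = work symbols.
-- States Fin (7 + m):
--   0 = start, 1 = query, 2 = answer-0, 3 = answer-1,
--   4 = halt-0, 5 = halt-1, 6 = halt-⊥, others = ordinary states.
-- In the query state the machine reads the binary number j written on the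
-- query tape (from cell 0 up to the first non-bit symbol) and moves in one
-- step to answer-1 if σ[j] = 1, otherwise to answer-0 (σ = oracle string).

data Move : Set where
  left right stay : Move

record Machine : Set where
  field
    e m : ℕ
    δ : Fin (7 + m) → Fin (4 + e) → Fin (4 + e) →
        Fin (7 + m) × Fin (4 + e) × Fin (4 + e) × Move × Move

record Config (M : Machine) : Set where
  constructor cfg
  field
    state : Fin (7 + Machine.m M)
    work  : List (Fin (4 + Machine.e M))
    wpos  : ℕ
    qtape : List (Fin (4 + Machine.e M))
    qpos  : ℕ

module _ {e : ℕ} where
  blank : Fin (4 + e)
  blank = zero

  readCell : List (Fin (4 + e)) → ℕ → Fin (4 + e)
  readCell []       _       = blank
  readCell (x ∷ xs) zero    = x
  readCell (x ∷ xs) (suc n) = readCell xs n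

  writeCell : List (Fin (4 + e)) → ℕ → Fin (4 + e) → List (Fin (4 + e))
  writeCell []       zero    a = a ∷ []
  writeCell []       (suc n) a = blank ∷ writeCell [] n a
  writeCell (x ∷ xs) zero    a = a ∷ xs
  writeCell (x ∷ xs) (suc n) a = x ∷ writeCell xs n a

  encBit : Bool → Fin (4 + e)
  encBit false = suc zero
  encBit true  = suc (suc zero)

  encBits : List Bool → List (Fin (4 + e))
  encBits = map encBit

  sep : Fin (4 + e)
  sep = suc (suc (suc zero))

  qvalFrom : ℕ → List (Fin (4 + e)) → ℕ
  qvalFrom acc []                       = acc
  qvalFrom acc (suc zero ∷ xs)          = qvalFrom (2 * acc) xs
  qvalFrom acc (suc (suc zero) ∷ xs)    = qvalFrom (suc (2 * acc)) xs
  qvalFrom acc (_ ∷ xs)                 = acc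

  qval : List (Fin (4 + e)) → ℕ
  qval = qvalFrom 0

  nonblank : List (Fin (4 + e)) → List (Fin (4 + e))
  nonblank []          = []
  nonblank (zero ∷ xs) = []
  nonblank (x ∷ xs)    = x ∷ nonblank xs

  consHead : Fin (4 + e) → List (List (Fin (4 + e))) → List (List (Fin (4 + e)))
  consHead x []         = (x ∷ []) ∷ []
  consHead x (s ∷ rest) = (x ∷ s) ∷ rest

  segments : List (Fin (4 + e)) → List (List (Fin (4 + e)))
  segments []                            = [] ∷ []
  segments (suc (suc (suc zero)) ∷ xs)   = [] ∷ segments xs
  segments (x ∷ xs)                      = consHead x (segments xs)

  decodeFrom : ℕ → List (Fin (4 + e)) → Maybe ℕ
  decodeFrom acc []                    = just acc
  decodeFrom acc (suc zero ∷ xs)       = decodeFrom (2 * acc) xs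
  decodeFrom acc (suc (suc zero) ∷ xs) = decodeFrom (suc (2 * acc)) xs
  decodeFrom acc (_ ∷ xs)              = nothing

  decodeSeg : List (Fin (4 + e)) → Maybe ℕ
  decodeSeg []       = nothing
  decodeSeg (x ∷ xs) = decodeFrom 0 (x ∷ xs)

  -- j is among the numbers printed (as a #-separated list of binary numerals)
  Printed : ℕ → List (Fin (4 + e)) → Set
  Printed j tape = just j ∈ map decodeSeg (segments (nonblank tape))

move : Move → ℕ → ℕ
move left  zero    = zero
move left  (suc n) = n
move right n       = suc n
move stay  n       = n

-- σ[j] (false when out of range)
bitAt : List Bool → ℕ → Bool
bitAt []      _       = false
bitAt (b ∷ σ) zero    = b
bitAt (b ∷ σ) (suc j) = bitAt σ j

module _ (M : Machine) where
  open Machine M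

  ordinary : List Bool → Config M → Config M
  ordinary σ (cfg q w wp qt qp) with δ q (readCell w wp) (readCell qt qp)
  ... | (q' , a , b , mw , mq) = cfg q' (writeCell w wp a) (move mw wp) (writeCell qt qp b) (move mq qp)

  step : List Bool → Config M → Config M
  step σ (cfg (suc zero) w wp qt qp) =
    cfg (if bitAt σ (qval qt) then suc (suc (suc zero)) else suc (suc zero)) w wp qt qp
  step σ c@(cfg (suc (suc (suc (suc zero)))) _ _ _ _) = c
  step σ c@(cfg (suc (suc (suc (suc (suc zero))))) _ _ _ _) = c
  step σ c@(cfg (suc (suc (suc (suc (suc (suc zero)))))) _ _ _ _) = c
  step σ c = ordinary σ c

  run : List Bool → ℕ → Config M → Config M
  run σ zero    c = c
  run σ (suc T) c = run σ T (step σ c)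

  queryOf : List Bool → Config M → List ℕ
  queryOf σ (cfg (suc zero) _ _ qt _) = qval qt ∷ []
  queryOf σ _                         = []

  queries : List Bool → ℕ → Config M → List ℕ
  queries σ zero    c = []
  queries σ (suc T) c = queryOf σ c ++ queries σ T (step σ c)

  Halted : Config M → Set
  Halted (cfg (suc (suc (suc (suc zero)))) _ _ _ _) = ⊤
  Halted (cfg (suc (suc (suc (suc (suc zero))))) _ _ _ _) = ⊤
  Halted (cfg (suc (suc (suc (suc (suc (suc zero)))))) _ _ _ _) = ⊤
  Halted _ = ⊥

  -- output of a halted configuration: halt-0 / halt-1 / halt-⊥
  -- (nothing = not halted; just nothing = ⊥)
  output : Config M → Maybe (Maybe Bool)
  output (cfg (suc (suc (suc (suc zero)))) _ _ _ _) = just (just false)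
  output (cfg (suc (suc (suc (suc (suc zero))))) _ _ _ _) = just (just true)
  output (cfg (suc (suc (suc (suc (suc (suc zero)))))) _ _ _ _) = just nothing
  output _ = nothing

  start : List (Fin (4 + e)) → Config M
  start inp = cfg zero inp 0 [] 0

  inputLoc : ℕ → ℕ → ℕ → List (Fin (4 + e))
  inputLoc len i k = encBits (strAt len) ++ sep ∷ encBits (bin i) ++ sep ∷ encBits (bin k)

  inputPrint : ℕ → ℕ → ℕ → List (Fin (4 + e))
  inputPrint n i k = encBits (replicate n true) ++ sep ∷ encBits (bin i) ++ sep ∷ encBits (bin k)

IndexedStrategy : Set
IndexedStrategy = ℕ → List Bool → List Bool

timeLoc : ℕ → ℕ → List Bool → ℕ → ℕ → ℕ
timeLoc c d τ i k = poly c d (⌈log₂ length τ ⌉ + ‖ i ‖ + ‖ k ‖)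

printerFinal : (P : Machine) → ℕ → ℕ → ℕ → ℕ → ℕ → Config P
printerFinal P c d n i k = run P [] (poly c d (n + ‖ i ‖ + ‖ k ‖)) (start P (inputPrint P n i k))

PLocComputable : IndexedStrategy → Set
PLocComputable h =
  Σ Machine λ M → Σ Machine λ P → Σ ℕ λ c → Σ ℕ λ d →
    (∀ τ i k → output M (run M τ (timeLoc c d τ i k) (start M (inputLoc M (length τ) i k)))
                 ≡ just (ext τ (h i τ) k))
  × -- the printer P prints G(n,i,k) within time t(n+|i|+|k|)
    (∀ n i k → Halted P (printerFinal P c d n i k))
  × -- locality: queries of M^σ(s_{|σ|}, i', k') lie in G(n,i,k)
    (∀ n i k i' k' σ → i' ≤ i → k' ≤ k → length σ ≤ 2 ^ n →
       ∀ j → j ∈ queries M σ (timeLoc c d σ i' k') (start M (inputLoc M (length σ) i' k')) →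
       Printed j (Config.work (printerFinal P c d n i k)))

PLocMeager : (Language → Set) → Set
PLocMeager X =
  Σ IndexedStrategy λ h →
    (∀ i → IsStrategy (h i)) × PLocComputable h × (∀ L → X L → Σ ℕ λ i → Avoids (h i) L)

-- The strategy h_i extends τ by a block of 2^C − 1 ones, where C = |s_|τ|| + |i| + 2.
-- With n = C − 1 we have |τ| < 2^n, so the block covers the positions 2^n − 1, …,
-- 2^(n+1) − 2 of all strings of length n: a language that h_i does not avoid contains
-- every string of length n.  A sparse language has census at most c·n^d + c < 2^n for all
-- n beyond some M, so it is avoided by h_i as soon as |i| ≥ M.
-- The k-th appended bit exists (and is 1) iff 1 ≤ k and |bin k| ≤ C.  A machine decides
-- this in time linear in |s_|τ|| + |i| + |k| without ever querying τ, so the locality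
-- condition holds with the empty query set, printed by a machine that halts at once.
module Submission where

open import Defs
open import Data.Nat
open import Data.Nat.Properties
open import Data.Nat.DivMod using (_/_; _%_; m≡m%n+[m/n]*n; m%n<n; m/n*n≤m; m*n/n≡m; /-monoˡ-≤; m*n%n≡0; [m+kn]%n≡m%n; +-distrib-/)
open import Data.Nat.Logarithm using (⌈log₂_⌉; ⌈log₂⌉-mono-≤; ⌈log₂2^n⌉≡n; ⌈log₂2*n⌉≡1+⌈log₂n⌉)
open import Data.Nat.ListAction using (sum)
open import Data.Nat.ListAction.Properties using (sum-++)
open import Data.Nat.Tactic.RingSolver using (solve-∀)
open import Data.Bool using (Bool; true; false; if_then_else_)
open import Data.Fin using (Fin; zero; suc)
open import Data.Fin.Properties using (all?) renaming (_≟_ to _≟ᶠ_)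
open import Data.List using (List; []; _∷_; _++_; length; reverse; map; drop; replicate)
open import Data.List.Properties using (reverse-++; reverse-involutive; length-reverse; map-++; map-∘; length-replicate)
open import Data.List.Membership.Propositional using (_∈_; _∉_)
open import Data.Maybe using (Maybe; just; nothing)
open import Data.Product using (∃; _×_; _,_; proj₁; proj₂)
open import Data.Unit using (tt)
open import Function using (_∘_; _⇔_; mk⇔)
open import Relation.Nullary using (contradiction)
open import Relation.Nullary.Decidable using (does-⇔; toWitness; ¬?)
open import Relation.Binary.PropositionalEquality

-- Exponentials dominate polynomials

n<2^n : ∀ n → n < 2 ^ n
n<2^n zero    = s≤s z≤n
n<2^n (suc n) = begin-strict
  suc n         ≤⟨ n<2^n n ⟩
  2 ^ n         <⟨ m<m+n (2 ^ n) (m^n>0 2 n) ⟩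
  2 ^ n + 2 ^ n ≡⟨ cong (2 ^ n +_) (+-identityʳ (2 ^ n)) ⟨
  2 ^ suc n     ∎
  where open ≤-Reasoning

^-distribʳ-* : ∀ m n o → (m * n) ^ o ≡ m ^ o * n ^ o
^-distribʳ-* m n zero    = refl
^-distribʳ-* m n (suc o) = begin
  m * n * (m * n) ^ o     ≡⟨ cong (m * n *_) (^-distribʳ-* m n o) ⟩
  m * n * (m ^ o * n ^ o) ≡⟨ *-interchange m n (m ^ o) (n ^ o) ⟩
  m * m ^ o * (n * n ^ o) ∎
  where
  open ≡-Reasoning
  *-interchange : ∀ a b c d → a * b * (c * d) ≡ a * c * (b * d)
  *-interchange = solve-∀

-- Halving: for m = ⌊n/2⌋ we have n ≤ 3m, so the induction hypothesis for the constant
-- c·3^(d+1) at m, together with m < 2^m, gives c·n^(d+1) < 2^m · 2^m ≤ 2^n.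
c*n^d<2^n : ∀ c d → ∃ λ M → ∀ n → M ≤ n → c * n ^ d < 2 ^ n
c*n^d<2^n c zero = c , λ n c≤n → begin-strict
  c * 1 ≡⟨ *-identityʳ c ⟩
  c     <⟨ n<2^n c ⟩
  2 ^ c ≤⟨ ^-monoʳ-≤ 2 c≤n ⟩
  2 ^ n ∎
  where open ≤-Reasoning
c*n^d<2^n c (suc d) with c*n^d<2^n (c * 3 ^ suc d) d
... | M , below = suc M * 2 , bound
  where
  open ≤-Reasoning
  bound : ∀ n → suc M * 2 ≤ n → c * n ^ suc d < 2 ^ n
  bound n 2M+2≤n = begin-strict
    c * n ^ suc d               ≤⟨ *-monoʳ-≤ c (^-monoˡ-≤ (suc d) n≤m*3) ⟩
    c * (m * 3) ^ suc d         ≡⟨ cong (c *_) (^-distribʳ-* m 3 (suc d)) ⟩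
    c * (m * m ^ d * 3 ^ suc d) ≡⟨ regroup c m (m ^ d) (3 ^ suc d) ⟩
    c * 3 ^ suc d * m ^ d * m   <⟨ *-mono-< (below m (≤-trans (n≤1+n M) M<m)) (n<2^n m) ⟩
    2 ^ m * 2 ^ m               ≡⟨ ^-distribˡ-+-* 2 m m ⟨
    2 ^ (m + m)                 ≤⟨ ^-monoʳ-≤ 2 m+m≤n ⟩
    2 ^ n                       ∎
    where
    m = n / 2
    M<m : suc M ≤ m
    M<m = ≤-trans (≤-reflexive (sym (m*n/n≡m (suc M) 2))) (/-monoˡ-≤ 2 2M+2≤n)
    m+m≤n : m + m ≤ n
    m+m≤n = ≤-trans (≤-reflexive (trans (cong (m +_) (sym (*-identityʳ m))) (sym (*-suc m 1)))) (m/n*n≤m n 2)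
    n≤m*3 : n ≤ m * 3
    n≤m*3 = begin
      n             ≡⟨ m≡m%n+[m/n]*n n 2 ⟩
      n % 2 + m * 2 ≤⟨ +-monoˡ-≤ (m * 2) (≤-trans (s≤s⁻¹ (m%n<n n 2)) (≤-trans (s≤s z≤n) M<m)) ⟩
      m + m * 2     ≡⟨ *-suc m 2 ⟨
      m * 3         ∎
    regroup : ∀ c m x t → c * (m * x * t) ≡ c * t * x * m
    regroup = solve-∀

poly<2^n : ∀ c d → ∃ λ M → ∀ n → M ≤ n → poly c d n < 2 ^ n
poly<2^n c d with c*n^d<2^n (c + c) d
... | M , below = suc M , bound
  where
  open ≤-Reasoning
  bound : ∀ n → suc M ≤ n → poly c d n < 2 ^ n
  bound n@(suc _) M<n = begin-strict
    c * n ^ d + c         ≤⟨ +-monoʳ-≤ (c * n ^ d) (m≤m*n c (n ^ d) {{m^n≢0 n d}}) ⟩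
    c * n ^ d + c * n ^ d ≡⟨ *-distribʳ-+ (n ^ d) c c ⟨
    (c + c) * n ^ d       <⟨ below n (≤-trans (n≤1+n M) M<n) ⟩
    2 ^ n                 ∎

-- Binary numerals and the enumeration s₀, s₁, …

bitValue : Bool → ℕ
bitValue false = 0
bitValue true  = 1

-- ⟦ r ⟧₁ is the number whose binary representation is 1 followed by reverse r.
⟦_⟧₁ : List Bool → ℕ
⟦ []    ⟧₁ = 1
⟦ b ∷ r ⟧₁ = bitValue b + 2 * ⟦ r ⟧₁

2^length≤⟦⟧₁ : ∀ r → 2 ^ length r ≤ ⟦ r ⟧₁
2^length≤⟦⟧₁ []      = ≤-refl
2^length≤⟦⟧₁ (b ∷ r) = ≤-trans (*-monoʳ-≤ 2 (2^length≤⟦⟧₁ r)) (m≤n+m (2 * ⟦ r ⟧₁) (bitValue b))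

⟦⟧₁<2^[1+length] : ∀ r → ⟦ r ⟧₁ < 2 ^ suc (length r)
⟦⟧₁<2^[1+length] []      = s≤s (s≤s z≤n)
⟦⟧₁<2^[1+length] (b ∷ r) = begin-strict
  bitValue b + 2 * ⟦ r ⟧₁ <⟨ +-monoˡ-< (2 * ⟦ r ⟧₁) (bitValue<2 b) ⟩
  2 + 2 * ⟦ r ⟧₁          ≡⟨ *-suc 2 ⟦ r ⟧₁ ⟨
  2 * suc ⟦ r ⟧₁          ≤⟨ *-monoʳ-≤ 2 (⟦⟧₁<2^[1+length] r) ⟩
  2 * 2 ^ suc (length r)  ∎
  where
  open ≤-Reasoning
  bitValue<2 : ∀ b → bitValue b < 2
  bitValue<2 false = s≤s z≤n
  bitValue<2 true  = s≤s (s≤s z≤n)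

⟦⟧₁>0 : ∀ r → ⟦ r ⟧₁ > 0
⟦⟧₁>0 r = ≤-trans (m^n>0 2 (length r)) (2^length≤⟦⟧₁ r)

increment : List Bool → List Bool
increment []          = false ∷ []
increment (false ∷ r) = true ∷ r
increment (true ∷ r)  = false ∷ increment r

⟦increment⟧₁ : ∀ r → ⟦ increment r ⟧₁ ≡ suc ⟦ r ⟧₁
⟦increment⟧₁ []          = refl
⟦increment⟧₁ (false ∷ r) = refl
⟦increment⟧₁ (true ∷ r)  = trans (cong (2 *_) (⟦increment⟧₁ r)) (*-suc 2 ⟦ r ⟧₁)

⟦⟧₁-surjective : ∀ n → ∃ λ r → ⟦ r ⟧₁ ≡ suc n
⟦⟧₁-surjective zero    = [] , refl
⟦⟧₁-surjective (suc n) with ⟦⟧₁-surjective n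
... | r , eq = increment r , trans (⟦increment⟧₁ r) (cong suc eq)

[b+2w]%2≡ᵇ1 : ∀ b w → ((bitValue b + 2 * w) % 2 ≡ᵇ 1) ≡ b
[b+2w]%2≡ᵇ1 false w = cong (_≡ᵇ 1) (trans (cong (_% 2) (*-comm 2 w)) (m*n%n≡0 w 2))
[b+2w]%2≡ᵇ1 true  w = cong (_≡ᵇ 1) (trans (cong (λ x → (1 + x) % 2) (*-comm 2 w)) ([m+kn]%n≡m%n 1 w 2))

[b+2w]/2≡w : ∀ b w → (bitValue b + 2 * w) / 2 ≡ w
[b+2w]/2≡w false w = trans (cong (_/ 2) (*-comm 2 w)) (m*n/n≡m w 2)
[b+2w]/2≡w true  w = begin
  (1 + 2 * w) / 2     ≡⟨ cong (λ x → (1 + x) / 2) (*-comm 2 w) ⟩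
  (1 + w * 2) / 2     ≡⟨ +-distrib-/ 1 (w * 2) (subst (λ x → 1 + x < 2) (sym (m*n%n≡0 w 2)) ≤-refl) ⟩
  1 / 2 + w * 2 / 2   ≡⟨ m*n/n≡m w 2 ⟩
  w                   ∎
  where open ≡-Reasoning

bitsRev-zero : ∀ f → bitsRev f 0 ≡ []
bitsRev-zero zero    = refl
bitsRev-zero (suc f) = refl

bitsRev-cons : ∀ f b n .{{_ : NonZero n}} → bitsRev (suc f) (bitValue b + 2 * n) ≡ b ∷ bitsRev f n
bitsRev-cons f b@false n@(suc _) = cong₂ _∷_ ([b+2w]%2≡ᵇ1 b n) (cong (bitsRev f) ([b+2w]/2≡w b n))
bitsRev-cons f b@true  n@(suc _) = cong₂ _∷_ ([b+2w]%2≡ᵇ1 b n) (cong (bitsRev f) ([b+2w]/2≡w b n))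

bitsRev-⟦⟧₁ : ∀ r f → length r < f → bitsRev f ⟦ r ⟧₁ ≡ r ++ true ∷ []
bitsRev-⟦⟧₁ []      (suc f) _           = cong (true ∷_) (bitsRev-zero f)
bitsRev-⟦⟧₁ (b ∷ r) (suc f) (s≤s |r|<f) = begin
  bitsRev (suc f) (bitValue b + 2 * ⟦ r ⟧₁) ≡⟨ bitsRev-cons f b ⟦ r ⟧₁ {{>-nonZero (⟦⟧₁>0 r)}} ⟩
  b ∷ bitsRev f ⟦ r ⟧₁                      ≡⟨ cong (b ∷_) (bitsRev-⟦⟧₁ r f |r|<f) ⟩
  b ∷ r ++ true ∷ []                        ∎
  where open ≡-Reasoning

bin-⟦⟧₁ : ∀ r → bin ⟦ r ⟧₁ ≡ true ∷ reverse r
bin-⟦⟧₁ r = begin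
  reverse (bitsRev ⟦ r ⟧₁ ⟦ r ⟧₁) ≡⟨ cong reverse (bitsRev-⟦⟧₁ r ⟦ r ⟧₁ enoughFuel) ⟩
  reverse (r ++ true ∷ [])        ≡⟨ reverse-++ r (true ∷ []) ⟩
  true ∷ reverse r                ∎
  where
  open ≡-Reasoning
  enoughFuel : length r < ⟦ r ⟧₁
  enoughFuel = <-≤-trans (n<2^n (length r)) (2^length≤⟦⟧₁ r)

strAt-⟦⟧₁ : ∀ r n → ⟦ r ⟧₁ ≡ suc n → strAt n ≡ reverse r
strAt-⟦⟧₁ r n eq = cong (drop 1) (trans (cong bin (sym eq)) (bin-⟦⟧₁ r))

bin-suc : ∀ n → bin (suc n) ≡ true ∷ strAt n
bin-suc n with ⟦⟧₁-surjective n
... | r , eq = trans bin≡ (cong (λ xs → true ∷ drop 1 xs) (sym bin≡))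
  where
  bin≡ : bin (suc n) ≡ true ∷ reverse r
  bin≡ = trans (cong bin (sym eq)) (bin-⟦⟧₁ r)

‖suc‖≡suc-length-strAt : ∀ n → ‖ suc n ‖ ≡ suc (length (strAt n))
‖suc‖≡suc-length-strAt n = cong length (bin-suc n)

strAt-length-bounds : ∀ n → 2 ^ length (strAt n) ≤ suc n × suc n < 2 ^ suc (length (strAt n))
strAt-length-bounds n with ⟦⟧₁-surjective n
... | r , eq rewrite strAt-⟦⟧₁ r n eq | length-reverse r | sym eq = 2^length≤⟦⟧₁ r , ⟦⟧₁<2^[1+length] r

strAt-surjective : ∀ w → ∃ λ p → strAt p ≡ w
strAt-surjective w with m≤n⇒∃[o]m+o≡n (⟦⟧₁>0 (reverse w))
... | p , eq = p , trans (strAt-⟦⟧₁ (reverse w) p (sym eq)) (reverse-involutive w)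

length-strAt≤⌈log₂⌉+1 : ∀ n → length (strAt n) ≤ ⌈log₂ n ⌉ + 1
length-strAt≤⌈log₂⌉+1 n = begin
  length (strAt n)             ≡⟨ ⌈log₂2^n⌉≡n (length (strAt n)) ⟨
  ⌈log₂ 2 ^ length (strAt n) ⌉ ≤⟨ ⌈log₂⌉-mono-≤ (proj₁ (strAt-length-bounds n)) ⟩
  ⌈log₂ suc n ⌉                ≤⟨ ⌈log₂suc⌉≤1+⌈log₂⌉ n ⟩
  suc ⌈log₂ n ⌉                ≡⟨ +-comm 1 ⌈log₂ n ⌉ ⟩
  ⌈log₂ n ⌉ + 1                ∎
  where
  open ≤-Reasoning
  ⌈log₂suc⌉≤1+⌈log₂⌉ : ∀ n → ⌈log₂ suc n ⌉ ≤ suc ⌈log₂ n ⌉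
  ⌈log₂suc⌉≤1+⌈log₂⌉ zero      = z≤n
  ⌈log₂suc⌉≤1+⌈log₂⌉ n@(suc _) =
    ≤-trans (⌈log₂⌉-mono-≤ (≤-trans (m<m*n n 2 ≤-refl) (≤-reflexive (*-comm n 2))))
            (≤-reflexive (⌈log₂2*n⌉≡1+⌈log₂n⌉ n))

‖‖-unbounded : ∀ M → ∃ λ i → M ≤ ‖ i ‖
‖‖-unbounded M with strAt-surjective (replicate M false)
... | p , eq = suc p , (begin
  M                          ≡⟨ length-replicate M ⟨
  length (replicate M false) ≡⟨ cong length eq ⟨
  length (strAt p)           <⟨ n<1+n _ ⟩
  suc (length (strAt p))     ≡⟨ ‖suc‖≡suc-length-strAt p ⟨
  ‖ suc p ‖                  ∎)
  where open ≤-Reasoning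

-- Avoiding sparse languages

sum-allStrings : ∀ n (g : List Bool → ℕ) → (∀ w → length w ≡ n → g w ≡ 1) →
                 sum (map g (allStrings n)) ≡ 2 ^ n
sum-allStrings zero    g g≡1 = cong (_+ 0) (g≡1 [] refl)
sum-allStrings (suc n) g g≡1 = begin
  sum (map g (map (false ∷_) ws ++ map (true ∷_) ws))
    ≡⟨ cong sum (map-++ g (map (false ∷_) ws) (map (true ∷_) ws)) ⟩
  sum (map g (map (false ∷_) ws) ++ map g (map (true ∷_) ws))
    ≡⟨ sum-++ (map g (map (false ∷_) ws)) (map g (map (true ∷_) ws)) ⟩
  sum (map g (map (false ∷_) ws)) + sum (map g (map (true ∷_) ws))
    ≡⟨ cong₂ _+_ (half false) (half true) ⟩
  2 ^ n + 2 ^ n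
    ≡⟨ cong (2 ^ n +_) (+-identityʳ (2 ^ n)) ⟨
  2 ^ suc n ∎
  where
  open ≡-Reasoning
  ws = allStrings n
  half : ∀ b → sum (map g (map (b ∷_) ws)) ≡ 2 ^ n
  half b = trans (cong sum (sym (map-∘ ws))) (sum-allStrings n (g ∘ (b ∷_)) (λ w eq → g≡1 (b ∷ w) (cong suc eq)))

census-full : ∀ L n → (∀ w → length w ≡ n → L w ≡ true) → census L n ≡ 2 ^ n
census-full L n full = sum-allStrings n _ (λ w eq → cong (λ b → if b then 1 else 0) (full w eq))

prefixFrom-++ : ∀ off τ u f → prefixFrom off (τ ++ u) f → prefixFrom (off + length τ) u f
prefixFrom-++ off []      u f pre       = subst (λ o → prefixFrom o u f) (sym (+-identityʳ off)) pre
prefixFrom-++ off (x ∷ τ) u f (_ , pre) =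
  subst (λ o → prefixFrom o u f) (sym (+-suc off (length τ))) (prefixFrom-++ (suc off) τ u f pre)

prefixFrom-replicate : ∀ off K x f j → prefixFrom off (replicate K x) f → j < K → f (off + j) ≡ x
prefixFrom-replicate off (suc K) x f zero    (x≡ , _)  _         = trans (cong f (+-identityʳ off)) (sym x≡)
prefixFrom-replicate off (suc K) x f (suc j) (_ , pre) (s≤s j<K) =
  trans (cong f (+-suc off j)) (prefixFrom-replicate (suc off) K x f j pre j<K)

ones : ℕ → List Bool
ones C = replicate (pred (2 ^ C)) true

ones⇒census≡2^ : ∀ L N n → prefixFrom N (ones (suc n)) (χ L) → N < 2 ^ n → census L n ≡ 2 ^ n
ones⇒census≡2^ L N n pre N<2^n = census-full L n inL
  where
  inL : ∀ w → length w ≡ n → L w ≡ true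
  inL w |w|≡n with strAt-surjective w
  ... | p , refl = subst (λ q → χ L q ≡ true) (m+[n∸m]≡n N≤p)
                         (prefixFrom-replicate N _ true (χ L) (p ∸ N) pre p∸N<pred[2^[1+n]])
    where
    open ≤-Reasoning
    bounds = strAt-length-bounds p
    N≤p : N ≤ p
    N≤p = s≤s⁻¹ (begin-strict
      N                    <⟨ N<2^n ⟩
      2 ^ n                ≡⟨ cong (2 ^_) |w|≡n ⟨
      2 ^ length (strAt p) ≤⟨ proj₁ bounds ⟩
      suc p                ∎)
    p∸N<pred[2^[1+n]] : p ∸ N < pred (2 ^ suc n)
    p∸N<pred[2^[1+n]] = <⇒≤pred (begin-strict
      suc (p ∸ N)                ≤⟨ s≤s (m∸n≤m p N) ⟩
      suc p                      <⟨ proj₂ bounds ⟩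
      2 ^ suc (length (strAt p)) ≡⟨ cong (λ m → 2 ^ suc m) |w|≡n ⟩
      2 ^ suc n                  ∎)

blockExponent : ℕ → ℕ → ℕ
blockExponent N i = 2 + length (strAt N) + ‖ i ‖

strategy : IndexedStrategy
strategy i τ = τ ++ ones (blockExponent (length τ) i)

strategy-isStrategy : ∀ i → IsStrategy (strategy i)
strategy-isStrategy i τ = _ , refl

strategy-avoids-sparse : ∀ L → SPARSE L → ∃ λ i → Avoids (strategy i) L
strategy-avoids-sparse L (c , d , sparse) with poly<2^n c d
... | M , poly<2^n-beyond-M with ‖‖-unbounded M
... | i , M≤‖i‖ = i , avoid
  where
  avoid : Avoids (strategy i) L
  avoid τ pre = <-irrefl full (≤-<-trans (sparse n (s≤s z≤n)) (poly<2^n-beyond-M n M≤n))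
    where
    open ≤-Reasoning
    N = length τ
    n = suc (length (strAt N)) + ‖ i ‖
    N<2^n : N < 2 ^ n
    N<2^n = begin-strict
      N                          <⟨ n<1+n N ⟩
      suc N                      <⟨ proj₂ (strAt-length-bounds N) ⟩
      2 ^ suc (length (strAt N)) ≤⟨ ^-monoʳ-≤ 2 (m≤m+n (suc (length (strAt N))) ‖ i ‖) ⟩
      2 ^ n                      ∎
    M≤n : M ≤ n
    M≤n = ≤-trans M≤‖i‖ (m≤n+m ‖ i ‖ _)
    full : census L n ≡ 2 ^ n
    full = ones⇒census≡2^ L N n (prefixFrom-++ 0 τ _ (χ L) pre) N<2^n

acceptIf : Bool → Maybe Bool
acceptIf true  = just true
acceptIf false = nothing

onesBit : List Bool → ℕ → Maybe Bool
onesBit []        C = nothing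
onesBit u@(_ ∷ _) C = acceptIf (length u ≤ᵇ C)

lookupMaybe-replicate : ∀ K k → lookupMaybe (replicate K true) k ≡ acceptIf (k <ᵇ K)
lookupMaybe-replicate zero    k       = refl
lookupMaybe-replicate (suc K) zero    = refl
lookupMaybe-replicate (suc K) (suc k) = lookupMaybe-replicate K k

drop-++ : ∀ {A : Set} (xs ys : List A) → drop (length xs) (xs ++ ys) ≡ ys
drop-++ []       ys = refl
drop-++ (x ∷ xs) ys = drop-++ xs ys

<pred[2^C]⇔suc-length-strAt≤C : ∀ k C → k < pred (2 ^ C) ⇔ suc (length (strAt k)) ≤ C
<pred[2^C]⇔suc-length-strAt≤C k C = mk⇔ to from
  where
  open ≤-Reasoning
  bounds = strAt-length-bounds k
  to : k < pred (2 ^ C) → suc (length (strAt k)) ≤ C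
  to k<pred[2^C] = ≰⇒> λ C≤|s| → <⇒≱ 1+k<2^C (begin
    2 ^ C                ≤⟨ ^-monoʳ-≤ 2 C≤|s| ⟩
    2 ^ length (strAt k) ≤⟨ proj₁ bounds ⟩
    suc k                ∎)
    where
    1+k<2^C : suc k < 2 ^ C
    1+k<2^C = ≤-trans (s≤s k<pred[2^C]) (≤-reflexive (suc-pred (2 ^ C) {{m^n≢0 2 C}}))
  from : suc (length (strAt k)) ≤ C → k < pred (2 ^ C)
  from |s|<C = <⇒≤pred (<-≤-trans (proj₂ bounds) (^-monoʳ-≤ 2 |s|<C))

ext-ones : ∀ τ C k → ext τ (τ ++ ones C) k ≡ onesBit (bin k) C
ext-ones τ C zero    = refl
ext-ones τ C (suc k) = begin
  lookupMaybe (drop (length τ) (τ ++ ones C)) k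
    ≡⟨ cong (λ u → lookupMaybe u k) (drop-++ τ (ones C)) ⟩
  lookupMaybe (ones C) k
    ≡⟨ lookupMaybe-replicate (pred (2 ^ C)) k ⟩
  acceptIf (k <ᵇ pred (2 ^ C))
    ≡⟨ cong acceptIf (does-⇔ (<pred[2^C]⇔suc-length-strAt≤C k C) (k <? pred (2 ^ C)) (suc (length (strAt k)) ≤? C)) ⟩
  acceptIf (suc (length (strAt k)) ≤ᵇ C)
    ≡⟨ cong (λ u → onesBit u C) (bin-suc k) ⟨
  onesBit (bin (suc k)) C ∎
  where open ≡-Reasoning

-- Turing machines

pattern querying = suc zero
pattern halt0    = suc (suc (suc (suc zero)))
pattern halt1    = suc (suc (suc (suc (suc zero))))
pattern halt⊥    = suc (suc (suc (suc (suc (suc zero)))))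
pattern own q    = suc (suc (suc (suc (suc (suc (suc q))))))

run-+ : ∀ M σ m n c → run M σ (m + n) c ≡ run M σ n (run M σ m c)
run-+ M σ zero    n c = refl
run-+ M σ (suc m) n c = run-+ M σ m n (step M σ c)

step-halted : ∀ M σ c → Halted M c → step M σ c ≡ c
step-halted M σ (cfg halt0 _ _ _ _) _ = refl
step-halted M σ (cfg halt1 _ _ _ _) _ = refl
step-halted M σ (cfg halt⊥ _ _ _ _) _ = refl

run-halted : ∀ M σ T c → Halted M c → run M σ T c ≡ c
run-halted M σ zero    c h = refl
run-halted M σ (suc T) c h = trans (cong (run M σ T) (step-halted M σ c h)) (run-halted M σ T c h)

NeverQueries : Machine → Set
NeverQueries M = ∀ q a b → proj₁ (Machine.δ M q a b) ≢ querying

queries-silent : ∀ M → NeverQueries M → ∀ σ T c → Config.state c ≢ querying → queries M σ T c ≡ []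
queries-silent M never σ zero    c _ = refl
queries-silent M never σ (suc T) c@(cfg zero _ _ _ _) _ =
  queries-silent M never σ T (step M σ c) (never _ _ _)
queries-silent M never σ (suc T) (cfg querying _ _ _ _) ¬querying = contradiction refl ¬querying
queries-silent M never σ (suc T) c@(cfg (suc (suc zero)) _ _ _ _) _ =
  queries-silent M never σ T (step M σ c) (never _ _ _)
queries-silent M never σ (suc T) c@(cfg (suc (suc (suc zero))) _ _ _ _) _ =
  queries-silent M never σ T (step M σ c) (never _ _ _)
queries-silent M never σ (suc T) c@(cfg halt0 _ _ _ _) ¬querying = queries-silent M never σ T c ¬querying
queries-silent M never σ (suc T) c@(cfg halt1 _ _ _ _) ¬querying = queries-silent M never σ T c ¬querying
queries-silent M never σ (suc T) c@(cfg halt⊥ _ _ _ _) ¬querying = queries-silent M never σ T c ¬querying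
queries-silent M never σ (suc T) c@(cfg (own _) _ _ _ _) _ =
  queries-silent M never σ T (step M σ c) (never _ _ _)

never-queried : ∀ M → NeverQueries M → ∀ σ T inp j → j ∉ queries M σ T (start M inp)
never-queried M never σ T inp j j∈ with subst (j ∈_) (queries-silent M never σ T (start M inp) (λ ())) j∈
... | ()

module _ {e : ℕ} where

  readCell-drop : ∀ W p {x : Fin (4 + e)} {xs} → drop p W ≡ x ∷ xs → readCell W p ≡ x
  readCell-drop (y ∷ W) zero    refl = refl
  readCell-drop (y ∷ W) (suc p) eq   = readCell-drop W p eq

  writeCell-drop : ∀ W p {x : Fin (4 + e)} {xs} → drop p W ≡ x ∷ xs → writeCell W p x ≡ W
  writeCell-drop (y ∷ W) zero    refl = refl
  writeCell-drop (y ∷ W) (suc p) eq   = cong (y ∷_) (writeCell-drop W p eq)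

  drop-suc : ∀ W p {x : Fin (4 + e)} {xs} → drop p W ≡ x ∷ xs → drop (suc p) W ≡ xs
  drop-suc (y ∷ W) zero    refl = refl
  drop-suc (y ∷ W) (suc p) eq   = drop-suc W p eq

  readCell-beyond : ∀ W p → drop p W ≡ [] → readCell W p ≡ blank {e}
  readCell-beyond []      p       _  = refl
  readCell-beyond (y ∷ W) (suc p) eq = readCell-beyond W p eq

  drop-encBits : ∀ W p u rest → drop p W ≡ encBits u ++ rest → drop (p + length u) W ≡ rest
  drop-encBits W p []      rest eq = trans (cong (λ q → drop q W) (+-identityʳ p)) eq
  drop-encBits W p (b ∷ u) rest eq =
    trans (cong (λ q → drop q W) (+-suc p (length u))) (drop-encBits W (suc p) u rest (drop-suc W p eq))

  drop-replicate : ∀ n r (x : Fin (4 + e)) → r < n → drop r (replicate n x) ≡ x ∷ replicate (n ∸ suc r) x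
  drop-replicate (suc n) zero    x _         = refl
  drop-replicate (suc n) (suc r) x (s≤s r<n) = drop-replicate n r x r<n

  writeCell-replicate : ∀ n (x : Fin (4 + e)) → writeCell (replicate n x) n x ≡ replicate (suc n) x
  writeCell-replicate zero    x = refl
  writeCell-replicate (suc n) x = cong (x ∷_) (writeCell-replicate n x)

-- The machine computing the strategy

pattern □ = zero
pattern 𝟘 = suc zero
pattern 𝟙 = suc (suc zero)
pattern ♯ = suc (suc (suc zero))

pattern initial = zero
pattern accept  = halt1
pattern reject  = halt⊥
pattern scanS   = own zero
pattern scanI   = own (suc zero)
pattern firstK  = own (suc (suc zero))
pattern restK   = own (suc (suc (suc zero)))

-- On input s ♯ bin i ♯ bin k the machine writes ♯ 𝟙^(|s| + |bin i| + 2) on its query tape,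
-- then moves the query head one cell left per bit of bin k: it accepts iff the bits run out
-- before the head reaches ♯, i.e. iff |bin k| ≤ |s| + |bin i| + 2; for k = 0 it rejects.
onesδ : Fin 11 → Fin 4 → Fin 4 → Fin 11 × Fin 4 × Fin 4 × Move × Move
onesδ initial a _ = scanS  , a , ♯ , stay  , right
onesδ scanS   𝟘 _ = scanS  , 𝟘 , 𝟙 , right , right
onesδ scanS   𝟙 _ = scanS  , 𝟙 , 𝟙 , right , right
onesδ scanS   ♯ _ = scanI  , ♯ , 𝟙 , right , right
onesδ scanI   𝟘 _ = scanI  , 𝟘 , 𝟙 , right , right
onesδ scanI   𝟙 _ = scanI  , 𝟙 , 𝟙 , right , right
onesδ scanI   ♯ _ = firstK , ♯ , 𝟙 , right , stay
onesδ firstK  𝟘 𝟙 = restK  , 𝟘 , 𝟙 , right , left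
onesδ firstK  𝟙 𝟙 = restK  , 𝟙 , 𝟙 , right , left
onesδ restK   𝟘 𝟙 = restK  , 𝟘 , 𝟙 , right , left
onesδ restK   𝟙 𝟙 = restK  , 𝟙 , 𝟙 , right , left
onesδ restK   □ b = accept , □ , b , stay  , stay
onesδ _       a b = reject , a , b , stay  , stay

onesTM : Machine
onesTM = record { e = 0 ; m = 4 ; δ = onesδ }

onesTM-never-queries : NeverQueries onesTM
onesTM-never-queries = toWitness {a? = all? λ q → all? λ a → all? λ b → ¬? (proj₁ (onesδ q a b) ≟ᶠ querying)} tt

counter : ℕ → List (Fin 4)
counter a = ♯ ∷ replicate a 𝟙

data Counting : Fin 11 → Set where
  scanS-counts : Counting scanS
  scanI-counts : Counting scanI

data Comparing : Fin 11 → Set where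
  firstK-compares : Comparing firstK
  restK-compares  : Comparing restK

start-step : ∀ σ s rest →
             step onesTM σ (start onesTM (encBits s ++ ♯ ∷ rest)) ≡ cfg scanS (encBits s ++ ♯ ∷ rest) 0 (counter 0) 1
start-step σ []      rest = refl
start-step σ (b ∷ s) rest = refl

count-step : ∀ σ {q} → Counting q → ∀ W p b {xs} a → drop p W ≡ encBit b ∷ xs →
             step onesTM σ (cfg q W p (counter a) (suc a)) ≡ cfg q W (suc p) (counter (suc a)) (suc (suc a))
count-step σ scanS-counts W p false a eq
  rewrite readCell-drop W p eq | writeCell-drop W p eq | writeCell-replicate {0} a 𝟙 = refl
count-step σ scanS-counts W p true  a eq
  rewrite readCell-drop W p eq | writeCell-drop W p eq | writeCell-replicate {0} a 𝟙 = refl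
count-step σ scanI-counts W p false a eq
  rewrite readCell-drop W p eq | writeCell-drop W p eq | writeCell-replicate {0} a 𝟙 = refl
count-step σ scanI-counts W p true  a eq
  rewrite readCell-drop W p eq | writeCell-drop W p eq | writeCell-replicate {0} a 𝟙 = refl

scanS-♯-step : ∀ σ W p {xs} a → drop p W ≡ ♯ ∷ xs →
               step onesTM σ (cfg scanS W p (counter a) (suc a)) ≡ cfg scanI W (suc p) (counter (suc a)) (suc (suc a))
scanS-♯-step σ W p a eq rewrite readCell-drop W p eq | writeCell-drop W p eq | writeCell-replicate {0} a 𝟙 = refl

scanI-♯-step : ∀ σ W p {xs} a → drop p W ≡ ♯ ∷ xs →
               step onesTM σ (cfg scanI W p (counter a) (suc a)) ≡ cfg firstK W (suc p) (counter (suc a)) (suc a)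
scanI-♯-step σ W p a eq rewrite readCell-drop W p eq | writeCell-drop W p eq | writeCell-replicate {0} a 𝟙 = refl

compare-step : ∀ σ {q} → Comparing q → ∀ W p b {xs} C r → drop p W ≡ encBit b ∷ xs → r < C →
               step onesTM σ (cfg q W p (counter C) (suc r)) ≡ cfg restK W (suc p) (counter C) r
compare-step σ firstK-compares W p false C r eq r<C
  rewrite readCell-drop W p eq | readCell-drop {0} _ r (drop-replicate C r 𝟙 r<C)
        | writeCell-drop W p eq | writeCell-drop {0} _ r (drop-replicate C r 𝟙 r<C) = refl
compare-step σ firstK-compares W p true  C r eq r<C
  rewrite readCell-drop W p eq | readCell-drop {0} _ r (drop-replicate C r 𝟙 r<C)
        | writeCell-drop W p eq | writeCell-drop {0} _ r (drop-replicate C r 𝟙 r<C) = refl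
compare-step σ restK-compares  W p false C r eq r<C
  rewrite readCell-drop W p eq | readCell-drop {0} _ r (drop-replicate C r 𝟙 r<C)
        | writeCell-drop W p eq | writeCell-drop {0} _ r (drop-replicate C r 𝟙 r<C) = refl
compare-step σ restK-compares  W p true  C r eq r<C
  rewrite readCell-drop W p eq | readCell-drop {0} _ r (drop-replicate C r 𝟙 r<C)
        | writeCell-drop W p eq | writeCell-drop {0} _ r (drop-replicate C r 𝟙 r<C) = refl

run-count : ∀ σ {q} → Counting q → ∀ W p u rest a → drop p W ≡ encBits u ++ rest →
            run onesTM σ (length u) (cfg q W p (counter a) (suc a))
            ≡ cfg q W (p + length u) (counter (a + length u)) (suc (a + length u))
run-count σ c W p []      rest a eq rewrite +-identityʳ p | +-identityʳ a = refl
run-count σ {q} c W p (b ∷ u) rest a eq = begin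
  run onesTM σ (length u) (step onesTM σ (cfg q W p (counter a) (suc a)))
    ≡⟨ cong (run onesTM σ (length u)) (count-step σ c W p b a eq) ⟩
  run onesTM σ (length u) (cfg q W (suc p) (counter (suc a)) (suc (suc a)))
    ≡⟨ run-count σ c W (suc p) u rest (suc a) (drop-suc W p eq) ⟩
  cfg q W (suc p + length u) (counter (suc a + length u)) (suc (suc a + length u))
    ≡⟨ cong₂ (λ x y → cfg q W x (counter y) (suc y)) (+-suc p (length u)) (+-suc a (length u)) ⟨
  cfg q W (p + suc (length u)) (counter (a + suc (length u))) (suc (a + suc (length u))) ∎
  where open ≡-Reasoning

-- Phrased with _<ᵇ_ so that it meets onesBit definitionally: suc m ≤ᵇ n unfolds to m <ᵇ n.
run-compare : ∀ σ W p u C r T → drop p W ≡ encBits u → r ≤ C → length u < T →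
              output onesTM (run onesTM σ T (cfg restK W p (counter C) r)) ≡ just (acceptIf (length u <ᵇ suc r))
run-compare σ W p []          C r       (suc T) eq _ _
  rewrite readCell-beyond W p eq = cong (output onesTM) (run-halted onesTM σ T _ tt)
run-compare σ W p (false ∷ u) C zero    (suc T) eq _ _
  rewrite readCell-drop W p eq = cong (output onesTM) (run-halted onesTM σ T _ tt)
run-compare σ W p (true ∷ u)  C zero    (suc T) eq _ _
  rewrite readCell-drop W p eq = cong (output onesTM) (run-halted onesTM σ T _ tt)
run-compare σ W p (b ∷ u)     C (suc r) (suc T) eq r<C (s≤s |u|<T) =
  trans (cong (λ c → output onesTM (run onesTM σ T c)) (compare-step σ restK-compares W p b C r eq r<C))
        (run-compare σ W (suc p) u C r T (drop-suc W p eq) (<⇒≤ r<C) |u|<T)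

run-decide : ∀ σ W p u C T → drop p W ≡ encBits u → length u < T →
             output onesTM (run onesTM σ T (cfg firstK W p (counter (suc C)) (suc C))) ≡ just (onesBit u (suc C))
run-decide σ W p []      C (suc T) eq _
  rewrite readCell-beyond W p eq = cong (output onesTM) (run-halted onesTM σ T _ tt)
run-decide σ W p (b ∷ u) C (suc T) eq (s≤s |u|<T) =
  trans (cong (λ c → output onesTM (run onesTM σ T c)) (compare-step σ firstK-compares W p b (suc C) C eq (n<1+n C)))
        (run-compare σ W (suc p) u (suc C) C T (drop-suc W p eq) (n≤1+n C) |u|<T)

input : List Bool → List Bool → List Bool → List (Fin 4)
input s i k = encBits s ++ ♯ ∷ encBits i ++ ♯ ∷ encBits k

input-first-♯ : ∀ s i k → drop (length s) (input s i k) ≡ ♯ ∷ encBits i ++ ♯ ∷ encBits k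
input-first-♯ s i k = drop-encBits (input s i k) 0 s (♯ ∷ encBits i ++ ♯ ∷ encBits k) refl

input-second-♯ : ∀ s i k → drop (suc (length s) + length i) (input s i k) ≡ ♯ ∷ encBits k
input-second-♯ s i k =
  drop-encBits (input s i k) (suc (length s)) i (♯ ∷ encBits k) (drop-suc (input s i k) (length s) (input-first-♯ s i k))

run-read : ∀ σ s i k → let C = 2 + length s + length i in
           run onesTM σ (suc (length s + suc (length i + 1))) (start onesTM (input s i k))
           ≡ cfg firstK (input s i k) C (counter C) C
run-read σ s i k = begin
  run onesTM σ (length s + suc (length i + 1)) (step onesTM σ (start onesTM W))
    ≡⟨ cong (run onesTM σ (length s + suc (length i + 1))) (start-step σ s (encBits i ++ ♯ ∷ encBits k)) ⟩
  run onesTM σ (length s + suc (length i + 1)) (cfg scanS W 0 (counter 0) 1)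
    ≡⟨ run-+ onesTM σ (length s) (suc (length i + 1)) (cfg scanS W 0 (counter 0) 1) ⟩
  run onesTM σ (suc (length i + 1)) (run onesTM σ (length s) (cfg scanS W 0 (counter 0) 1))
    ≡⟨ cong (run onesTM σ (suc (length i + 1))) (run-count σ scanS-counts W 0 s _ 0 refl) ⟩
  run onesTM σ (suc (length i + 1)) (cfg scanS W (length s) (counter (length s)) (suc (length s)))
    ≡⟨ cong (run onesTM σ (length i + 1)) (scanS-♯-step σ W (length s) (length s) (input-first-♯ s i k)) ⟩
  run onesTM σ (length i + 1) (scanning-i (suc (length s)))
    ≡⟨ run-+ onesTM σ (length i) 1 (scanning-i (suc (length s))) ⟩
  step onesTM σ (run onesTM σ (length i) (scanning-i (suc (length s))))
    ≡⟨ cong (step onesTM σ) (run-count σ scanI-counts W (suc (length s)) i _ (suc (length s)) at-i) ⟩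
  step onesTM σ (scanning-i (suc (length s) + length i))
    ≡⟨ scanI-♯-step σ W (suc (length s) + length i) (suc (length s) + length i) (input-second-♯ s i k) ⟩
  cfg firstK W (2 + length s + length i) (counter (2 + length s + length i)) (2 + length s + length i) ∎
  where
  open ≡-Reasoning
  W = input s i k
  scanning-i : ℕ → Config onesTM
  scanning-i p = cfg scanI W p (counter p) (suc p)
  at-i : drop (suc (length s)) W ≡ encBits i ++ ♯ ∷ encBits k
  at-i = drop-suc W (length s) (input-first-♯ s i k)

onesTM-output : ∀ σ s i k T → length s + length i + length k + 4 ≤ T →
                output onesTM (run onesTM σ T (start onesTM (input s i k))) ≡ just (onesBit k (2 + length s + length i))
onesTM-output σ s i k T time with m≤n⇒∃[o]m+o≡n time
... | o , refl = begin
  output onesTM (run onesTM σ (length s + length i + length k + 4 + o) (start onesTM W))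
    ≡⟨ cong (λ t → output onesTM (run onesTM σ t (start onesTM W))) (split (length s) (length i) (length k) o) ⟩
  output onesTM (run onesTM σ (reading + (suc (length k) + o)) (start onesTM W))
    ≡⟨ cong (output onesTM) (run-+ onesTM σ reading (suc (length k) + o) (start onesTM W)) ⟩
  output onesTM (run onesTM σ (suc (length k) + o) (run onesTM σ reading (start onesTM W)))
    ≡⟨ cong (λ c → output onesTM (run onesTM σ (suc (length k) + o) c)) (run-read σ s i k) ⟩
  output onesTM (run onesTM σ (suc (length k) + o) (cfg firstK W C (counter C) C))
    ≡⟨ run-decide σ W C k (suc (length s) + length i) (suc (length k) + o) at-k (s≤s (m≤m+n (length k) o)) ⟩
  just (onesBit k C) ∎
  where
  open ≡-Reasoning
  W = input s i k
  C = 2 + length s + length i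
  reading = suc (length s + suc (length i + 1))
  split : ∀ a b c o → a + b + c + 4 + o ≡ suc (a + suc (b + 1)) + (suc c + o)
  split = solve-∀
  at-k : drop C W ≡ encBits k
  at-k = drop-suc W (suc (length s) + length i) (input-second-♯ s i k)

time-bound : ∀ N i k → length (strAt N) + ‖ i ‖ + ‖ k ‖ + 4 ≤ poly 5 1 (⌈log₂ N ⌉ + ‖ i ‖ + ‖ k ‖)
time-bound N i k = begin
  length (strAt N) + ‖ i ‖ + ‖ k ‖ + 4
    ≤⟨ +-monoˡ-≤ 4 (+-monoˡ-≤ ‖ k ‖ (+-monoˡ-≤ ‖ i ‖ (length-strAt≤⌈log₂⌉+1 N))) ⟩
  ⌈log₂ N ⌉ + 1 + ‖ i ‖ + ‖ k ‖ + 4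
    ≡⟨ regroup ⌈log₂ N ⌉ ‖ i ‖ ‖ k ‖ ⟩
  x + 5
    ≤⟨ +-monoˡ-≤ 5 (≤-trans (m≤n*m x 5) (≤-reflexive (cong (5 *_) (sym (*-identityʳ x))))) ⟩
  5 * x ^ 1 + 5 ∎
  where
  open ≤-Reasoning
  x = ⌈log₂ N ⌉ + ‖ i ‖ + ‖ k ‖
  regroup : ∀ l a b → l + 1 + a + b + 4 ≡ l + a + b + 5
  regroup = solve-∀

onesTM-computes-strategy : ∀ τ i k →
  output onesTM (run onesTM τ (timeLoc 5 1 τ i k) (start onesTM (inputLoc onesTM (length τ) i k)))
  ≡ just (ext τ (strategy i τ) k)
onesTM-computes-strategy τ i k =
  trans (onesTM-output τ (strAt (length τ)) (bin i) (bin k) (timeLoc 5 1 τ i k) (time-bound (length τ) i k))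
        (cong just (sym (ext-ones τ (blockExponent (length τ) i) k)))

emptyPrinter : Machine
emptyPrinter = record { e = 0 ; m = 0 ; δ = λ _ a b → halt0 , a , b , stay , stay }

emptyPrinter-halts : ∀ inp T → 1 ≤ T → Halted emptyPrinter (run emptyPrinter [] T (start emptyPrinter inp))
emptyPrinter-halts inp (suc T) _ = subst (Halted emptyPrinter) (sym (run-halted emptyPrinter [] T _ tt)) tt

emptyPrinter-halts-in-time : ∀ n i k → Halted emptyPrinter (printerFinal emptyPrinter 5 1 n i k)
emptyPrinter-halts-in-time n i k =
  emptyPrinter-halts (inputPrint emptyPrinter n i k) (poly 5 1 x) (≤-trans (s≤s z≤n) (m≤n+m 5 (5 * x ^ 1)))
  where x = n + ‖ i ‖ + ‖ k ‖

mainTheorem13 : PLocMeager SPARSE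
mainTheorem13 =
  strategy , strategy-isStrategy ,
  ( onesTM , emptyPrinter , 5 , 1
  , onesTM-computes-strategy
  , emptyPrinter-halts-in-time
  , λ _ _ _ i k σ _ _ _ j j∈ → contradiction j∈
      (never-queried onesTM onesTM-never-queries σ (timeLoc 5 1 σ i k) (inputLoc onesTM (length σ) i k) j) ) ,
  strategy-avoids-sparse
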